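{- (a) $\mathbf{HA_1}$ does not prove $\mathrm{QF\text{ - }AC_{00}}$. (b) $\mathbf{IA_1}$ does not prove $\mathrm{QF\text{ - }AC_{00}}$.
   Context: All systems are based on two-sorted intuitionistic predicate logic with number variables (natural numbers) and function variables (one-place number-theoretic functions); number equality is primitive. $\mathbf{IA_1}$: language with $0,',+,\cdot$ and finitely many further primitive recursive function(al) constants (exponentiation, factorial, predecessor, cut-off subtraction, min, max, $\mathrm{sg}$, $\overline{\mathrm{sg}}$, $|a-b|$, remainder, quotient, bounded sums/products/min/max of function values, prime enumeration, exponent, length, concatenation, $\overline{\alpha}(x)$, $\widetilde{\alpha}(x)$, $a\circ b$, Kleene's $\mathrm{ccp}$), application and $\lambda$-abstraction; axioms: Peano axioms for $0,',+,\cdot$, equality axioms, defining equations, $x=y\to\alpha(x)=\alpha(y)$, $\lambda$-conversion $(\lambda x.t(x))(s)=t(s)$, induction for all formulas. $\mathbf{HA_1}$: $0$, a constant for each primitive recursive description, application, $\lambda$, recursor $\mathrm{rec}$; axioms $x=x$, $A(x)\,\&\,x=y\to A(y)$, induction, $\neg S(0)=0$, defining equations, $\lambda$-conversion, $\mathrm{rec}(t,u,0)=t$, $\mathrm{rec}(t,u,S(s))=u(\langle\mathrm{rec}(t,u,s),s\rangle)$ with $\langle a,b\rangle=2^a3^b$. $\mathrm{QF\text{ - }AC_{00}}$: $\forall x\exists y\,A(x,y)\to\exists\alpha\forall x\,A(x,\alpha(x))$ for quantifier-free $A$ not containing $\alpha$. -}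

module Defs where

open import Data.Nat using (ℕ; zero; suc)
open import Data.Fin using (Fin; zero; suc) renaming (_<_ to _<ᶠ_)
open import Data.Vec using (Vec; []; _∷_; lookup)
open import Data.List using (List; []; _∷_; map)
open import Data.List.Membership.Propositional using (_∈_)
open import Data.Product using (_×_)
open import Data.Unit using (⊤)
open import Relation.Binary.PropositionalEquality using (_≡_)
open import Function using (id)

-- Generic two-sorted language (number terms / function terms), with
-- de Bruijn indices for number variables and for function variables
-- (two independent index spaces), 0, function(al) constants given by a
-- signature, application and λ-abstraction.

record Sig : Set₁ where
  field
    Con : Set
    nAr : Con → ℕ
    fAr : Con → ℕ

module Syntax (Σ : Sig) where
  open Sig Σ

  mutual
    data Tm : Set where
      var : ℕ → Tm
      zer : Tm
      con : (c : Con) → Vec Tm (nAr c) → Vec Fn (fAr c) → Tm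
      ap  : Fn → Tm → Tm

    data Fn : Set where
      fvar : ℕ → Fn
      lam  : Tm → Fn          -- λ binds number variable 0

  liftR : (ℕ → ℕ) → ℕ → ℕ
  liftR ρ zero    = zero
  liftR ρ (suc i) = suc (ρ i)

  mutual
    renT : (ℕ → ℕ) → (ℕ → ℕ) → Tm → Tm
    renT ρ π (var i)       = var (ρ i)
    renT ρ π zer           = zer
    renT ρ π (con c ts fs) = con c (renTs ρ π ts) (renFs ρ π fs)
    renT ρ π (ap f t)      = ap (renF ρ π f) (renT ρ π t)

    renF : (ℕ → ℕ) → (ℕ → ℕ) → Fn → Fn
    renF ρ π (fvar j) = fvar (π j)
    renF ρ π (lam t)  = lam (renT (liftR ρ) π t)

    renTs : ∀ {n} → (ℕ → ℕ) → (ℕ → ℕ) → Vec Tm n → Vec Tm n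
    renTs ρ π []       = []
    renTs ρ π (t ∷ ts) = renT ρ π t ∷ renTs ρ π ts

    renFs : ∀ {n} → (ℕ → ℕ) → (ℕ → ℕ) → Vec Fn n → Vec Fn n
    renFs ρ π []       = []
    renFs ρ π (f ∷ fs) = renF ρ π f ∷ renFs ρ π fs

  liftNσ : (ℕ → Tm) → ℕ → Tm
  liftNσ σ zero    = var zero
  liftNσ σ (suc i) = renT suc id (σ i)

  liftNτ : (ℕ → Fn) → ℕ → Fn
  liftNτ τ j = renF suc id (τ j)

  liftFσ : (ℕ → Tm) → ℕ → Tm
  liftFσ σ i = renT id suc (σ i)

  liftFτ : (ℕ → Fn) → ℕ → Fn
  liftFτ τ zero    = fvar zero
  liftFτ τ (suc j) = renF id suc (τ j)

  mutual
    subT : (ℕ → Tm) → (ℕ → Fn) → Tm → Tm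
    subT σ τ (var i)       = σ i
    subT σ τ zer           = zer
    subT σ τ (con c ts fs) = con c (subTs σ τ ts) (subFs σ τ fs)
    subT σ τ (ap f t)      = ap (subF σ τ f) (subT σ τ t)

    subF : (ℕ → Tm) → (ℕ → Fn) → Fn → Fn
    subF σ τ (fvar j) = τ j
    subF σ τ (lam t)  = lam (subT (liftNσ σ) (liftNτ τ) t)

    subTs : ∀ {n} → (ℕ → Tm) → (ℕ → Fn) → Vec Tm n → Vec Tm n
    subTs σ τ []       = []
    subTs σ τ (t ∷ ts) = subT σ τ t ∷ subTs σ τ ts

    subFs : ∀ {n} → (ℕ → Tm) → (ℕ → Fn) → Vec Fn n → Vec Fn n
    subFs σ τ []       = []
    subFs σ τ (f ∷ fs) = subF σ τ f ∷ subFs σ τ fs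

  infix  7 _≐_
  infixr 6 _∧'_
  infixr 5 _∨'_
  infixr 4 _⇒_
  data Fm : Set where
    _≐_  : Tm → Tm → Fm
    ⊥'   : Fm
    _⇒_  : Fm → Fm → Fm
    _∧'_ : Fm → Fm → Fm
    _∨'_ : Fm → Fm → Fm
    ∀n   : Fm → Fm      -- binds number variable 0
    ∃n   : Fm → Fm
    ∀f   : Fm → Fm      -- binds function variable 0
    ∃f   : Fm → Fm

  ¬' : Fm → Fm
  ¬' A = A ⇒ ⊥'

  renFm : (ℕ → ℕ) → (ℕ → ℕ) → Fm → Fm
  renFm ρ π (s ≐ t)   = renT ρ π s ≐ renT ρ π t
  renFm ρ π ⊥'        = ⊥'
  renFm ρ π (A ⇒ B)   = renFm ρ π A ⇒ renFm ρ π B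
  renFm ρ π (A ∧' B)  = renFm ρ π A ∧' renFm ρ π B
  renFm ρ π (A ∨' B)  = renFm ρ π A ∨' renFm ρ π B
  renFm ρ π (∀n A)    = ∀n (renFm (liftR ρ) π A)
  renFm ρ π (∃n A)    = ∃n (renFm (liftR ρ) π A)
  renFm ρ π (∀f A)    = ∀f (renFm ρ (liftR π) A)
  renFm ρ π (∃f A)    = ∃f (renFm ρ (liftR π) A)

  subFm : (ℕ → Tm) → (ℕ → Fn) → Fm → Fm
  subFm σ τ (s ≐ t)   = subT σ τ s ≐ subT σ τ t
  subFm σ τ ⊥'        = ⊥'
  subFm σ τ (A ⇒ B)   = subFm σ τ A ⇒ subFm σ τ B
  subFm σ τ (A ∧' B)  = subFm σ τ A ∧' subFm σ τ B
  subFm σ τ (A ∨' B)  = subFm σ τ A ∨' subFm σ τ B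
  subFm σ τ (∀n A)    = ∀n (subFm (liftNσ σ) (liftNτ τ) A)
  subFm σ τ (∃n A)    = ∃n (subFm (liftNσ σ) (liftNτ τ) A)
  subFm σ τ (∀f A)    = ∀f (subFm (liftFσ σ) (liftFτ τ) A)
  subFm σ τ (∃f A)    = ∃f (subFm (liftFσ σ) (liftFτ τ) A)

  shN : Fm → Fm
  shN = renFm suc id

  shF : Fm → Fm
  shF = renFm id suc

  -- substitution of a term for number variable 0 (other variables move down)
  sub0 : Tm → ℕ → Tm
  sub0 s zero    = s
  sub0 s (suc i) = var i

  -- substitution of a term for number variable 0 (other variables unchanged)
  sub0keep : Tm → ℕ → Tm
  sub0keep s zero    = s
  sub0keep s (suc i) = var (suc i)

  fsub0 : Fn → ℕ → Fn
  fsub0 φ zero    = φ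
  fsub0 φ (suc j) = fvar j

  _[_]t : Tm → Tm → Tm
  t [ s ]t = subT (sub0 s) fvar t

  _[_]n : Fm → Tm → Fm
  A [ s ]n = subFm (sub0 s) fvar A

  _[_]f : Fm → Fn → Fm
  A [ φ ]f = subFm var (fsub0 φ) A

  data QF : Fm → Set where
    qf-eq  : ∀ s t → QF (s ≐ t)
    qf-bot : QF ⊥'
    qf-imp : ∀ {A B} → QF A → QF B → QF (A ⇒ B)
    qf-and : ∀ {A B} → QF A → QF B → QF (A ∧' B)
    qf-or  : ∀ {A B} → QF A → QF B → QF (A ∨' B)

  -- The QF-AC₀₀ instance for A(x,y):  in A, number variable 1 is x,
  -- number variable 0 is y, and variables 2,3,… / function variables
  -- 0,1,… are parameters.  The bound α cannot occur in A.
  --   ∀x ∃y A(x,y) → ∃α ∀x A(x, α(x))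
  qfacσ : ℕ → Tm
  qfacσ zero          = ap (fvar zero) (var zero)
  qfacσ (suc zero)    = var zero
  qfacσ (suc (suc i)) = var (suc i)

  QFAC : Fm → Fm
  QFAC A = ∀n (∃n A) ⇒ ∃f (∀n (subFm qfacσ (λ j → fvar (suc j)) A))

  module Deriv (Ax : Fm → Set) where
    infix 2 _⊢_
    data _⊢_ : List Fm → Fm → Set where
      hyp : ∀ {Γ A} → A ∈ Γ → Γ ⊢ A
      ax  : ∀ {Γ A} → Ax A → Γ ⊢ A
      ⇒I  : ∀ {Γ A B} → (A ∷ Γ) ⊢ B → Γ ⊢ A ⇒ B
      ⇒E  : ∀ {Γ A B} → Γ ⊢ A ⇒ B → Γ ⊢ A → Γ ⊢ B
      ∧I  : ∀ {Γ A B} → Γ ⊢ A → Γ ⊢ B → Γ ⊢ A ∧' B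
      ∧E₁ : ∀ {Γ A B} → Γ ⊢ A ∧' B → Γ ⊢ A
      ∧E₂ : ∀ {Γ A B} → Γ ⊢ A ∧' B → Γ ⊢ B
      ∨I₁ : ∀ {Γ A B} → Γ ⊢ A → Γ ⊢ A ∨' B
      ∨I₂ : ∀ {Γ A B} → Γ ⊢ B → Γ ⊢ A ∨' B
      ∨E  : ∀ {Γ A B C} → Γ ⊢ A ∨' B → (A ∷ Γ) ⊢ C → (B ∷ Γ) ⊢ C → Γ ⊢ C
      ⊥E  : ∀ {Γ A} → Γ ⊢ ⊥' → Γ ⊢ A
      ∀nI : ∀ {Γ A} → map shN Γ ⊢ A → Γ ⊢ ∀n A
      ∀nE : ∀ {Γ A} → Γ ⊢ ∀n A → (t : Tm) → Γ ⊢ A [ t ]n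
      ∃nI : ∀ {Γ A} → (t : Tm) → Γ ⊢ A [ t ]n → Γ ⊢ ∃n A
      ∃nE : ∀ {Γ A B} → Γ ⊢ ∃n A → (A ∷ map shN Γ) ⊢ shN B → Γ ⊢ B
      ∀fI : ∀ {Γ A} → map shF Γ ⊢ A → Γ ⊢ ∀f A
      ∀fE : ∀ {Γ A} → Γ ⊢ ∀f A → (φ : Fn) → Γ ⊢ A [ φ ]f
      ∃fI : ∀ {Γ A} → (φ : Fn) → Γ ⊢ A [ φ ]f → Γ ⊢ ∃f A
      ∃fE : ∀ {Γ A B} → Γ ⊢ ∃f A → (A ∷ map shF Γ) ⊢ shF B → Γ ⊢ B

    Proves : Fm → Set
    Proves A = [] ⊢ A

  -- default-extended argument lists (used for defining equations)
  vσ : ∀ {n} → Vec Tm n → ℕ → Tm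
  vσ []       _       = zer
  vσ (t ∷ ts) zero    = t
  vσ (t ∷ ts) (suc j) = vσ ts j

  vτ : ∀ {n} → Vec Fn n → ℕ → Fn
  vτ []       _       = lam zer
  vτ (f ∷ fs) zero    = f
  vτ (f ∷ fs) (suc j) = vτ fs j

data PR : ℕ → Set where
  succ : PR 1
  zro  : (n : ℕ) → PR n
  proj : ∀ {n} → Fin n → PR n
  comp : ∀ {m n} → PR m → Vec (PR n) m → PR n
  prec : ∀ {n} → PR n → PR (suc (suc n)) → PR (suc n)
  -- prec g h (0, x⃗) = g(x⃗) ;  prec g h (y+1, x⃗) = h(prec g h (y,x⃗), y, x⃗)

addPR : PR 2
addPR = prec (proj zero) (comp succ (proj zero ∷ []))

mulPR : PR 2
mulPR = prec (zro 1) (comp addPR (proj zero ∷ proj (suc (suc zero)) ∷ []))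

onePR : PR 0
onePR = comp succ (zro 0 ∷ [])

numPR2 : PR 2     -- constant 2 (binary)
numPR2 = comp succ (comp succ (zro 2 ∷ []) ∷ [])

numPR2' : PR 2    -- constant 3 (binary)
numPR2' = comp succ (numPR2 ∷ [])

pow2PR : PR 1
pow2PR = prec onePR (comp mulPR (proj zero ∷ numPR2 ∷ []))

pow3PR : PR 1
pow3PR = prec onePR (comp mulPR (proj zero ∷ numPR2' ∷ []))

pairPR : PR 2     -- ⟨a,b⟩ = 2^a · 3^b
pairPR = comp mulPR (comp pow2PR (proj zero ∷ []) ∷ comp pow3PR (proj (suc zero) ∷ []) ∷ [])

data HACon : Set where
  pr  : (n : ℕ) → PR n → HACon
  rec : HACon

HAnAr : HACon → ℕ
HAnAr (pr n f) = n
HAnAr rec      = 2      -- rec(t, u, s): number args t, s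

HAfAr : HACon → ℕ
HAfAr (pr n f) = 0
HAfAr rec      = 1      -- function arg u

HASig : Sig
HASig = record { Con = HACon ; nAr = HAnAr ; fAr = HAfAr }

module HA1 where
  open Syntax HASig public

  appPR : ∀ {n} → PR n → Vec Tm n → Tm
  appPR {n} f ts = con (pr n f) ts []

  S : Tm → Tm
  S t = appPR succ (t ∷ [])

  mapApp : ∀ {m n} → Vec (PR n) m → Vec Tm n → Vec Tm m
  mapApp []       ts = []
  mapApp (h ∷ hs) ts = appPR h ts ∷ mapApp hs ts

  pair : Tm → Tm → Tm
  pair a b = appPR pairPR (a ∷ b ∷ [])

  recT : Tm → Fn → Tm → Tm
  recT t u s = con rec (t ∷ s ∷ []) (u ∷ [])

  data Ax : Fm → Set where
    eq-refl : ∀ t → Ax (t ≐ t)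
    eq-repl : ∀ A s t → Ax (A [ s ]n ∧' s ≐ t ⇒ A [ t ]n)
    ind     : ∀ A → Ax (A [ zer ]n ∧' ∀n (A ⇒ subFm (sub0keep (S (var zero))) fvar A) ⇒ ∀n A)
    S≠0     : Ax (¬' (S zer ≐ zer))
    d-zro   : ∀ n ts → Ax (appPR (zro n) ts ≐ zer)
    d-proj  : ∀ {n} (i : Fin n) ts → Ax (appPR (proj i) ts ≐ lookup ts i)
    d-comp  : ∀ {m n} (g : PR m) (hs : Vec (PR n) m) ts →
              Ax (appPR (comp g hs) ts ≐ appPR g (mapApp hs ts))
    d-prec0 : ∀ {n} (g : PR n) h ts →
              Ax (appPR (prec g h) (zer ∷ ts) ≐ appPR g ts)
    d-precS : ∀ {n} (g : PR n) h s ts →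
              Ax (appPR (prec g h) (S s ∷ ts) ≐ appPR h (appPR (prec g h) (s ∷ ts) ∷ s ∷ ts))
    lam-conv : ∀ t s → Ax (ap (lam t) s ≐ t [ s ]t)
    rec0    : ∀ t u → Ax (recT t u zer ≐ t)
    recS    : ∀ t u s → Ax (recT t u (S s) ≐ ap u (pair (recT t u s) s))

  open Deriv Ax public

-- IA₁ : 0, ', +, · and finitely many further primitive recursive
-- function(al) constants, each introduced by an explicit definition or
-- a primitive recursion (on its first number argument) in terms of the
-- previously introduced constants.

data IACon (K : ℕ) : Set where
  sc pl ml : IACon K
  ext      : Fin K → IACon K

IASig : (K : ℕ) → (Fin K → ℕ) → (Fin K → ℕ) → Sig
IASig K kA mA = record { Con = IACon K ; nAr = nA ; fAr = fA }
  where
    nA : IACon K → ℕ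
    nA sc      = 1
    nA pl      = 2
    nA ml      = 2
    nA (ext i) = kA i
    fA : IACon K → ℕ
    fA (ext i) = mA i
    fA _       = 0

module IADef {K : ℕ} (kA mA : Fin K → ℕ) where
  open Syntax (IASig K kA mA)

  BelowC : Fin K → IACon K → Set
  BelowC i (ext j) = j <ᶠ i
  BelowC i _       = ⊤

  mutual
    BelowT : Fin K → Tm → Set
    BelowT i (var _)       = ⊤
    BelowT i zer           = ⊤
    BelowT i (con c ts fs) = BelowC i c × BelowTs i ts × BelowFs i fs
    BelowT i (ap f t)      = BelowF i f × BelowT i t

    BelowF : Fin K → Fn → Set
    BelowF i (fvar _) = ⊤
    BelowF i (lam t)  = BelowT i t

    BelowTs : ∀ {n} → Fin K → Vec Tm n → Set
    BelowTs i []       = ⊤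
    BelowTs i (t ∷ ts) = BelowT i t × BelowTs i ts

    BelowFs : ∀ {n} → Fin K → Vec Fn n → Set
    BelowFs i []       = ⊤
    BelowFs i (f ∷ fs) = BelowF i f × BelowFs i fs

  -- definition of constant i:
  --  explicit t :  c(x₀..x_{k-1}, α₀..α_{m-1}) = t   (x_j = var j, α_j = fvar j)
  --  primrec t₀ t₁ (k = k'+1):
  --      c(0, x⃗, α⃗)  = t₀           (x_j = var j)
  --      c(y', x⃗, α⃗) = t₁           (var 0 = c(y,x⃗,α⃗), var 1 = y, var (j+2) = x_j)
  data Defn (i : Fin K) : Set where
    explicit : (t : Tm) → BelowT i t → Defn i
    primrec  : (t₀ t₁ : Tm) → BelowT i t₀ → BelowT i t₁ → (kA i ≡ suc (Data.Nat.pred (kA i))) → Defn i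

record IAExt : Set where
  field
    K    : ℕ
    kA   : Fin K → ℕ
    mA   : Fin K → ℕ
    defn : (i : Fin K) → IADef.Defn kA mA i

module IA1 (E : IAExt) where
  open IAExt E
  open Syntax (IASig K kA mA) public
  open IADef kA mA

  S : Tm → Tm
  S t = con sc (t ∷ []) []

  _+ᵗ_ : Tm → Tm → Tm
  a +ᵗ b = con pl (a ∷ b ∷ []) []

  _·ᵗ_ : Tm → Tm → Tm
  a ·ᵗ b = con ml (a ∷ b ∷ []) []

  vsetHead : ∀ {n} → Tm → Vec Tm n → Vec Tm n
  vsetHead s []       = []
  vsetHead s (_ ∷ ts) = s ∷ ts

  vtail : ∀ {n} → Vec Tm n → ℕ → Tm
  vtail []       = vσ ([] {A = Tm})
  vtail (_ ∷ ts) = vσ ts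

  recσ : Tm → Tm → (ℕ → Tm) → ℕ → Tm
  recσ p y xs zero          = p
  recσ p y xs (suc zero)    = y
  recσ p y xs (suc (suc j)) = xs j

  data Ax : Fm → Set where
    eq-refl  : ∀ t → Ax (t ≐ t)
    eq-repl  : ∀ A s t → Ax (A [ s ]n ∧' s ≐ t ⇒ A [ t ]n)
    eq-fun   : ∀ φ s t → Ax (s ≐ t ⇒ ap φ s ≐ ap φ t)
    ind      : ∀ A → Ax (A [ zer ]n ∧' ∀n (A ⇒ subFm (sub0keep (S (var zero))) fvar A) ⇒ ∀n A)
    S-inj    : ∀ s t → Ax (S s ≐ S t ⇒ s ≐ t)
    S≠0      : ∀ s → Ax (¬' (S s ≐ zer))
    plus0    : ∀ a → Ax (a +ᵗ zer ≐ a)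
    plusS    : ∀ a b → Ax (a +ᵗ S b ≐ S (a +ᵗ b))
    times0   : ∀ a → Ax (a ·ᵗ zer ≐ zer)
    timesS   : ∀ a b → Ax (a ·ᵗ S b ≐ (a ·ᵗ b) +ᵗ a)
    lam-conv : ∀ t s → Ax (ap (lam t) s ≐ t [ s ]t)
    d-expl   : ∀ i t b (ts : Vec Tm (kA i)) (fs : Vec Fn (mA i)) →
               defn i ≡ explicit t b →
               Ax (con (ext i) ts fs ≐ subT (vσ ts) (vτ fs) t)
    d-rec0   : ∀ i t₀ t₁ b₀ b₁ e (ts : Vec Tm (kA i)) (fs : Vec Fn (mA i)) →
               defn i ≡ primrec t₀ t₁ b₀ b₁ e →
               Ax (con (ext i) (vsetHead zer ts) fs ≐ subT (vtail ts) (vτ fs) t₀)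
    d-recS   : ∀ i t₀ t₁ b₀ b₁ e s (ts : Vec Tm (kA i)) (fs : Vec Fn (mA i)) →
               defn i ≡ primrec t₀ t₁ b₀ b₁ e →
               Ax (con (ext i) (vsetHead (S s) ts) fs
                   ≐ subT (recσ (con (ext i) (vsetHead s ts) fs) s (vtail ts)) (vτ fs) t₁)

  open Deriv Ax public

-- Both theories are sound for the model in which number variables range over ℕ but function
-- variables range only over the functions dominated by some level F k of an Ackermann-style
-- hierarchy.  Every constant of HA₁ (primitive recursive functions, the recursor) and of IA₁
-- (explicit and primitive recursive definitions) is majorizable: arguments below m and functions
-- below F k give a value below F k′ m.  Hence every λ-term denotes a dominated function and all
-- axioms and rules are valid.  Now let β invert the diagonal D x = F x x on its range and send
-- everything else to 0.  β is dominated and onto, so ∀x ∃y β(y) = x holds; a choice function α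
-- with β(α(x)) = x, however, satisfies α(x) = D(x) for x ≥ 1 and escapes every level F k.

module Submission where

open import Defs
open import Data.Nat
open import Data.Nat.Properties
open import Data.Nat.GeneralisedArithmetic using (fold)
open import Data.Empty using (⊥; ⊥-elim)
open import Data.Unit using (⊤; tt)
open import Data.Product using (Σ; _×_; _,_; proj₁; proj₂)
open import Data.Product.Function.NonDependent.Propositional using (_×-⇔_)
open import Data.Sum using (_⊎_; inj₁; inj₂)
open import Data.Sum.Function.Propositional using (_⊎-⇔_)
open import Data.Fin using (Fin; toℕ) renaming (_<_ to _<ᶠ_)
open import Data.Fin.Properties using (toℕ<n)
open import Data.Fin.Induction using (<-wellFounded)
open import Data.List using (List; []; _∷_; map)
import Data.List.Relation.Unary.All as ListAll
import Data.List.Relation.Unary.All.Properties as ListAll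
open import Data.Vec using (Vec; []; _∷_; lookup)
open import Data.Vec.Relation.Unary.All using (All; []; _∷_)
import Data.Vec.Relation.Unary.All as All
open import Data.Vec.Relation.Unary.All.Properties using (lookup⁺)
open import Data.Vec.Relation.Binary.Pointwise.Inductive using (Pointwise; []; _∷_)
open import Function using (id; _∘_)
open import Function.Bundles using (_⇔_; mk⇔; Equivalence)
import Function.Properties.Equivalence as ⇔
open import Function.Related.TypeIsomorphisms using (→-cong-⇔)
import Induction.WellFounded as WF
open import Relation.Binary using (_Preserves_⟶_)
open import Relation.Binary.PropositionalEquality
open import Relation.Nullary using (¬_; yes; no; contradiction)

-- A fast-growing hierarchy

Inflationary : (ℕ → ℕ) → Set
Inflationary f = ∀ x → x < f x

module _ {f : ℕ → ℕ} (f-infl : Inflationary f) where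

  n+x≤fold : ∀ n x → n + x ≤ fold x f n
  n+x≤fold zero    x = ≤-refl
  n+x≤fold (suc n) x = ≤-<-trans (n+x≤fold n x) (f-infl _)

  x≤fold : ∀ n x → x ≤ fold x f n
  x≤fold n x = ≤-trans (m≤n+m x n) (n+x≤fold n x)

  n≤fold : ∀ n x → n ≤ fold x f n
  n≤fold n x = ≤-trans (m≤m+n n x) (n+x≤fold n x)

  fold-mono : f Preserves _≤_ ⟶ _≤_ →
              ∀ {n n′ x x′} → n ≤ n′ → x ≤ x′ → fold x f n ≤ fold x′ f n′
  fold-mono f-mono {n′ = n′} z≤n       x≤x′ = ≤-trans x≤x′ (x≤fold n′ _)
  fold-mono f-mono           (s≤s n≤n′) x≤x′ = f-mono (fold-mono f-mono n≤n′ x≤x′)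

F : ℕ → ℕ → ℕ
F zero    x = suc (suc x)
F (suc k) x = fold x (F k) (suc (suc x))

mutual
  F-inflationary : ∀ k → Inflationary (F k)
  F-inflationary zero    x = s≤s (n≤1+n x)
  F-inflationary (suc k) x =
    ≤-<-trans (x≤fold (F-inflationary k) (suc x) x) (F-inflationary k _)

  F-monoʳ : ∀ k → F k Preserves _≤_ ⟶ _≤_
  F-monoʳ zero    x≤y = s≤s (s≤s x≤y)
  F-monoʳ (suc k) x≤y = fold-mono (F-inflationary k) (F-monoʳ k) (s≤s (s≤s x≤y)) x≤y

F∘F≤F-suc : ∀ k x → F k (F k x) ≤ F (suc k) x
F∘F≤F-suc k x = fold-mono (F-inflationary k) (F-monoʳ k) {2} {suc (suc x)} (s≤s (s≤s z≤n)) ≤-refl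

F<F-suc : ∀ k x → F k x < F (suc k) x
F<F-suc k x = <-≤-trans (F-inflationary k (F k x)) (F∘F≤F-suc k x)

F-monoˡ : ∀ {k k′} → k ≤ k′ → ∀ x → F k x ≤ F k′ x
F-monoˡ k≤k′ x = go (≤⇒≤′ k≤k′)
  where
  go : ∀ {k k′} → k ≤′ k′ → F k x ≤ F k′ x
  go ≤′-refl       = ≤-refl
  go (≤′-step {n} k≤n) = ≤-trans (go k≤n) (<⇒≤ (F<F-suc n x))

F-mono : ∀ {k k′ x y} → k ≤ k′ → x ≤ y → F k x ≤ F k′ y
F-mono {k} {y = y} k≤k′ x≤y = ≤-trans (F-monoʳ k x≤y) (F-monoˡ k≤k′ y)

F-compose : ∀ a b m → F a (F b m) ≤ F (suc (a ⊔ b)) m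
F-compose a b m = begin
  F a (F b m)             ≤⟨ F-mono (m≤m⊔n a b) (F-monoˡ (m≤n⊔m a b) m) ⟩
  F (a ⊔ b) (F (a ⊔ b) m) ≤⟨ F∘F≤F-suc (a ⊔ b) m ⟩
  F (suc (a ⊔ b)) m       ∎
  where open ≤-Reasoning

fold-F≤F-suc : ∀ k n x → fold x (F k) n ≤ F (suc k) (n ⊔ x)
fold-F≤F-suc k n x = fold-mono (F-inflationary k) (F-monoʳ k)
  (≤-trans (m≤m⊔n n x) (≤-trans (n≤1+n _) (n≤1+n _))) (m≤n⊔m n x)

m+m≤F1 : ∀ m → m + m ≤ F 1 m
m+m≤F1 m =
  ≤-trans (+-monoˡ-≤ m (≤-trans (n≤1+n m) (n≤1+n _))) (n+x≤fold (F-inflationary 0) (suc (suc m)) m)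

n*m≤fold-F1 : ∀ n m → n * m ≤ fold m (F 1) n
n*m≤fold-F1 zero    m = z≤n
n*m≤fold-F1 (suc n) m =
  ≤-trans (+-mono-≤ (x≤fold (F-inflationary 1) n m) (n*m≤fold-F1 n m)) (m+m≤F1 (fold m (F 1) n))

+≤F1 : ∀ {x y m} → x ≤ m → y ≤ m → x + y ≤ F 1 m
+≤F1 {m = m} x≤m y≤m = ≤-trans (+-mono-≤ x≤m y≤m) (m+m≤F1 m)

*≤F2 : ∀ {x y m} → x ≤ m → y ≤ m → x * y ≤ F 2 m
*≤F2 {m = m} x≤m y≤m =
  ≤-trans (*-mono-≤ (≤-trans x≤m (≤-trans (n≤1+n m) (n≤1+n _))) y≤m) (n*m≤fold-F1 (suc (suc m)) m)

Bounded : ℕ → ℕ → (ℕ → ℕ) → Set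
Bounded k m g = ∀ x → g x ≤ F k (x ⊔ m)

Dominated : (ℕ → ℕ) → Set
Dominated g = Σ ℕ λ k → Σ ℕ λ m → Bounded k m g

Bounded-mono : ∀ {k k′ m m′ g} → k ≤ k′ → m ≤ m′ → Bounded k m g → Bounded k′ m′ g
Bounded-mono k≤k′ m≤m′ bound x = ≤-trans (bound x) (F-mono k≤k′ (⊔-monoʳ-≤ x m≤m′))

Majorizable : ∀ {n l} → (Vec ℕ n → Vec (ℕ → ℕ) l → ℕ) → Set
Majorizable f = ∀ k → Σ ℕ λ k′ → ∀ m {xs gs} → All (_≤ m) xs → All (Bounded k m) gs → f xs gs ≤ F k′ m

Majorizable-cong : ∀ {n l} {f g : Vec ℕ n → Vec (ℕ → ℕ) l → ℕ} → (∀ xs gs → f xs gs ≡ g xs gs) →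
                   Majorizable g → Majorizable f
Majorizable-cong f≡g g-maj k with g-maj k
... | k′ , g≤ = k′ , λ m {xs} {gs} xs≤ gs≤ → ≤-trans (≤-reflexive (f≡g xs gs)) (g≤ m xs≤ gs≤)

iteration-bound : ∀ (a : ℕ → ℕ) k₀ k₁ m → a 0 ≤ F k₀ m →
                  (∀ y z → a y ≤ z → y ≤ z → m ≤ z → a (suc y) ≤ F k₁ z) →
                  ∀ y → y ≤ m → a y ≤ F (suc (suc k₁ ⊔ k₀)) m
iteration-bound a k₀ k₁ m a₀≤ step y y≤m = begin
  a y                     ≤⟨ below-orbit y ⟩
  fold (F k₀ m) (F k₁) y  ≤⟨ fold-F≤F-suc k₁ y (F k₀ m) ⟩
  F (suc k₁) (y ⊔ F k₀ m) ≡⟨ cong (F (suc k₁)) (m≤n⇒m⊔n≡n (≤-trans y≤m m≤F)) ⟩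
  F (suc k₁) (F k₀ m)     ≤⟨ F-compose (suc k₁) k₀ m ⟩
  F (suc (suc k₁ ⊔ k₀)) m ∎
  where
  open ≤-Reasoning
  m≤F : m ≤ F k₀ m
  m≤F = <⇒≤ (F-inflationary k₀ m)
  below-orbit : ∀ y → a y ≤ fold (F k₀ m) (F k₁) y
  below-orbit zero    = a₀≤
  below-orbit (suc y) = step y _ (below-orbit y) (n≤fold (F-inflationary k₁) y _)
                          (≤-trans m≤F (x≤fold (F-inflationary k₁) y _))

-- The inverse of the diagonal

D : ℕ → ℕ
D x = F x x

D<D-suc : ∀ x → D x < D (suc x)
D<D-suc x = <-≤-trans (F<F-suc x x) (F-monoʳ (suc x) (n≤1+n x))

D-strictMono : ∀ {x y} → x < y → D x < D y
D-strictMono {x} {suc y} x<1+y with m≤n⇒m<n∨m≡n (≤-pred x<1+y)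
... | inj₁ x<y  = <-trans (D-strictMono x<y) (D<D-suc y)
... | inj₂ refl = D<D-suc x

D-injective : ∀ {x y} → D x ≡ D y → x ≡ y
D-injective {x} {y} Dx≡Dy = ≤-antisym (reflects Dx≡Dy) (reflects (sym Dx≡Dy))
  where
  reflects : ∀ {x y} → D x ≡ D y → x ≤ y
  reflects Dx≡Dy = ≮⇒≥ λ y<x → <-irrefl (sym Dx≡Dy) (D-strictMono y<x)

search : ℕ → ℕ → ℕ
search y zero    = zero
search y (suc n) with D (suc n) ≟ y
... | yes _ = suc n
... | no  _ = search y n

search-≤ : ∀ y n → search y n ≤ n
search-≤ y zero    = z≤n
search-≤ y (suc n) with D (suc n) ≟ y
... | yes _ = ≤-refl
... | no  _ = m≤n⇒m≤1+n (search-≤ y n)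

search-sound : ∀ y n {x} → search y n ≡ suc x → D (suc x) ≡ y
search-sound y (suc n) found with D (suc n) ≟ y
... | yes Dn≡y = trans (cong D (sym found)) Dn≡y
... | no  _    = search-sound y n found

search-complete : ∀ {x} y n → x < n → D (suc x) ≡ y → search y n ≡ suc x
search-complete y (suc n) x<1+n Dx≡y with D (suc n) ≟ y
... | yes Dn≡y = D-injective (trans Dn≡y (sym Dx≡y))
... | no  Dn≢y with m≤n⇒m<n∨m≡n (≤-pred x<1+n)
...   | inj₁ x<n   = search-complete y n x<n Dx≡y
...   | inj₂ refl  = contradiction Dx≡y Dn≢y

β : ℕ → ℕ
β y = search y y

β-bounded : Bounded 0 0 β
β-bounded y = ≤-trans (search-≤ y y) (≤-trans (m≤m⊔n y 0) (<⇒≤ (F-inflationary 0 _)))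

β-surjective : ∀ x → Σ ℕ λ y → β y ≡ x
β-surjective zero    = zero , refl
β-surjective (suc x) = D (suc x) , search-complete _ _ x<D[1+x] refl
  where x<D[1+x] = <-trans (n<1+n x) (F-inflationary (suc x) (suc x))

β-no-dominated-section : ∀ α → Dominated α → ¬ (∀ x → β (α x) ≡ x)
β-no-dominated-section α (k , c , bound) section = <-irrefl αx≡Dx αx<Dx
  where
  x = suc (k + c)
  αx≡Dx : α x ≡ D x
  αx≡Dx = sym (search-sound (α x) (α x) (section x))
  αx<Dx : α x < D x
  αx<Dx = begin-strict
    α x           ≤⟨ bound x ⟩
    F k (x ⊔ c)   ≡⟨ cong (F k) (m≥n⇒m⊔n≡m (m≤n⇒m≤1+n (m≤n+m c k))) ⟩
    F k x         <⟨ F<F-suc k x ⟩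
    F (suc k) x   ≤⟨ F-monoˡ (s≤s (m≤m+n k c)) x ⟩
    D x           ∎
    where open ≤-Reasoning

open Equivalence using (to; from)

-- Semantics with function quantifiers over dominated functions

infixr 5 _∷ᵉ_
_∷ᵉ_ : ∀ {A : Set} → A → (ℕ → A) → ℕ → A
(x ∷ᵉ ρ) zero    = x
(x ∷ᵉ ρ) (suc i) = ρ i

Π-cong-⇔ : ∀ {A : Set} {P Q : A → Set} → (∀ x → P x ⇔ Q x) → ((x : A) → P x) ⇔ ((x : A) → Q x)
Π-cong-⇔ P⇔Q = mk⇔ (λ p x → to (P⇔Q x) (p x)) (λ q x → from (P⇔Q x) (q x))

Σ-cong-⇔ : ∀ {A : Set} {P Q : A → Set} → (∀ x → P x ⇔ Q x) → Σ A P ⇔ Σ A Q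
Σ-cong-⇔ P⇔Q = mk⇔ (λ (x , p) → x , to (P⇔Q x) p) (λ (x , q) → x , from (P⇔Q x) q)

≡-cong-⇔ : ∀ {a a′ b b′ : ℕ} → a ≡ a′ → b ≡ b′ → (a ≡ b) ⇔ (a′ ≡ b′)
≡-cong-⇔ a≡a′ b≡b′ = mk⇔ (subst₂ _≡_ a≡a′ b≡b′) (subst₂ _≡_ (sym a≡a′) (sym b≡b′))

module Semantics (L : Sig) where
  open Sig L
  open Syntax L

  Interpretation : Set
  Interpretation = (c : Con) → Vec ℕ (nAr c) → Vec (ℕ → ℕ) (fAr c) → ℕ

  Extensional : Interpretation → Set
  Extensional I = ∀ c xs {gs hs} → Pointwise _≗_ gs hs → I c xs gs ≡ I c xs hs

  module _ (P : Con → Set) where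
    mutual
      AllConstT : Tm → Set
      AllConstT (var _)       = ⊤
      AllConstT zer           = ⊤
      AllConstT (con c ts fs) = P c × AllConstTs ts × AllConstFs fs
      AllConstT (ap f t)      = AllConstF f × AllConstT t

      AllConstF : Fn → Set
      AllConstF (fvar _) = ⊤
      AllConstF (lam t)  = AllConstT t

      AllConstTs : ∀ {n} → Vec Tm n → Set
      AllConstTs []       = ⊤
      AllConstTs (t ∷ ts) = AllConstT t × AllConstTs ts

      AllConstFs : ∀ {n} → Vec Fn n → Set
      AllConstFs []       = ⊤
      AllConstFs (f ∷ fs) = AllConstF f × AllConstFs fs

  module _ {P : Con → Set} (all : ∀ c → P c) where
    mutual
      allConstT : ∀ t → AllConstT P t
      allConstT (var _)       = tt
      allConstT zer           = tt
      allConstT (con c ts fs) = all c , allConstTs ts , allConstFs fs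
      allConstT (ap f t)      = allConstF f , allConstT t

      allConstF : ∀ f → AllConstF P f
      allConstF (fvar _) = tt
      allConstF (lam t)  = allConstT t

      allConstTs : ∀ {n} (ts : Vec Tm n) → AllConstTs P ts
      allConstTs []       = tt
      allConstTs (t ∷ ts) = allConstT t , allConstTs ts

      allConstFs : ∀ {n} (fs : Vec Fn n) → AllConstFs P fs
      allConstFs []       = tt
      allConstFs (f ∷ fs) = allConstF f , allConstFs fs

  module Eval (I : Interpretation) where
    mutual
      evalT : (ℕ → ℕ) → (ℕ → ℕ → ℕ) → Tm → ℕ
      evalT ρ η (var i)       = ρ i
      evalT ρ η zer           = 0
      evalT ρ η (con c ts fs) = I c (evalTs ρ η ts) (evalFs ρ η fs)
      evalT ρ η (ap f t)      = evalF ρ η f (evalT ρ η t)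

      evalF : (ℕ → ℕ) → (ℕ → ℕ → ℕ) → Fn → ℕ → ℕ
      evalF ρ η (fvar j) = η j
      evalF ρ η (lam t) x = evalT (x ∷ᵉ ρ) η t

      evalTs : ∀ {n} → (ℕ → ℕ) → (ℕ → ℕ → ℕ) → Vec Tm n → Vec ℕ n
      evalTs ρ η []       = []
      evalTs ρ η (t ∷ ts) = evalT ρ η t ∷ evalTs ρ η ts

      evalFs : ∀ {n} → (ℕ → ℕ) → (ℕ → ℕ → ℕ) → Vec Fn n → Vec (ℕ → ℕ) n
      evalFs ρ η []       = []
      evalFs ρ η (f ∷ fs) = evalF ρ η f ∷ evalFs ρ η fs

    ⟦_⟧ : Fm → (ℕ → ℕ) → (ℕ → ℕ → ℕ) → Set
    ⟦ s ≐ t ⟧  ρ η = evalT ρ η s ≡ evalT ρ η t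
    ⟦ ⊥' ⟧     ρ η = ⊥
    ⟦ A ⇒ B ⟧  ρ η = ⟦ A ⟧ ρ η → ⟦ B ⟧ ρ η
    ⟦ A ∧' B ⟧ ρ η = ⟦ A ⟧ ρ η × ⟦ B ⟧ ρ η
    ⟦ A ∨' B ⟧ ρ η = ⟦ A ⟧ ρ η ⊎ ⟦ B ⟧ ρ η
    ⟦ ∀n A ⟧   ρ η = (x : ℕ) → ⟦ A ⟧ (x ∷ᵉ ρ) η
    ⟦ ∃n A ⟧   ρ η = Σ ℕ λ x → ⟦ A ⟧ (x ∷ᵉ ρ) η
    ⟦ ∀f A ⟧   ρ η = (g : ℕ → ℕ) → Dominated g → ⟦ A ⟧ ρ (g ∷ᵉ η)
    ⟦ ∃f A ⟧   ρ η = Σ (ℕ → ℕ) λ g → Dominated g × ⟦ A ⟧ ρ (g ∷ᵉ η)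

    module Substitution (I-ext : Extensional I) where

      liftR-eval : ∀ {r} {ρ ρ′ : ℕ → ℕ} {x} → (∀ i → ρ (r i) ≡ ρ′ i) →
                   ∀ i → (x ∷ᵉ ρ) (liftR r i) ≡ (x ∷ᵉ ρ′) i
      liftR-eval hr zero    = refl
      liftR-eval hr (suc i) = hr i

      liftR-evalF : ∀ {p} {η η′ : ℕ → ℕ → ℕ} {g} → (∀ j → η (p j) ≗ η′ j) →
                    ∀ j → (g ∷ᵉ η) (liftR p j) ≗ (g ∷ᵉ η′) j
      liftR-evalF hp zero    y = refl
      liftR-evalF hp (suc j) y = hp j y

      mutual
        evalT-ren : ∀ t r p {ρ η ρ′ η′} → (∀ i → ρ (r i) ≡ ρ′ i) → (∀ j → η (p j) ≗ η′ j) →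
                    evalT ρ η (renT r p t) ≡ evalT ρ′ η′ t
        evalT-ren (var i)       r p hr hp = hr i
        evalT-ren zer           r p hr hp = refl
        evalT-ren (con c ts fs) r p hr hp =
          trans (cong (λ xs → I c xs _) (evalTs-ren ts r p hr hp)) (I-ext c _ (evalFs-ren fs r p hr hp))
        evalT-ren (ap f t)      r p {ρ} {η} hr hp =
          trans (cong (evalF ρ η (renF r p f)) (evalT-ren t r p hr hp)) (evalF-ren f r p hr hp _)

        evalF-ren : ∀ f r p {ρ η ρ′ η′} → (∀ i → ρ (r i) ≡ ρ′ i) → (∀ j → η (p j) ≗ η′ j) →
                    evalF ρ η (renF r p f) ≗ evalF ρ′ η′ f
        evalF-ren (fvar j) r p hr hp   = hp j
        evalF-ren (lam t)  r p hr hp x = evalT-ren t (liftR r) p (liftR-eval hr) hp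

        evalTs-ren : ∀ {n} (ts : Vec Tm n) r p {ρ η ρ′ η′} →
                     (∀ i → ρ (r i) ≡ ρ′ i) → (∀ j → η (p j) ≗ η′ j) →
                     evalTs ρ η (renTs r p ts) ≡ evalTs ρ′ η′ ts
        evalTs-ren []       r p hr hp = refl
        evalTs-ren (t ∷ ts) r p hr hp = cong₂ _∷_ (evalT-ren t r p hr hp) (evalTs-ren ts r p hr hp)

        evalFs-ren : ∀ {n} (fs : Vec Fn n) r p {ρ η ρ′ η′} →
                     (∀ i → ρ (r i) ≡ ρ′ i) → (∀ j → η (p j) ≗ η′ j) →
                     Pointwise _≗_ (evalFs ρ η (renFs r p fs)) (evalFs ρ′ η′ fs)
        evalFs-ren []       r p hr hp = []
        evalFs-ren (f ∷ fs) r p hr hp = evalF-ren f r p hr hp ∷ evalFs-ren fs r p hr hp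

      evalT-shiftN : ∀ t {x ρ η} → evalT (x ∷ᵉ ρ) η (renT suc id t) ≡ evalT ρ η t
      evalT-shiftN t = evalT-ren t suc id (λ _ → refl) (λ _ _ → refl)

      evalF-shiftN : ∀ f {x ρ η} → evalF (x ∷ᵉ ρ) η (renF suc id f) ≗ evalF ρ η f
      evalF-shiftN f = evalF-ren f suc id (λ _ → refl) (λ _ _ → refl)

      evalT-shiftF : ∀ t {g ρ η} → evalT ρ (g ∷ᵉ η) (renT id suc t) ≡ evalT ρ η t
      evalT-shiftF t = evalT-ren t id suc (λ _ → refl) (λ _ _ → refl)

      evalF-shiftF : ∀ f {g ρ η} → evalF ρ (g ∷ᵉ η) (renF id suc f) ≗ evalF ρ η f
      evalF-shiftF f = evalF-ren f id suc (λ _ → refl) (λ _ _ → refl)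

      evalT-cong : ∀ t {ρ η ρ′ η′} → ρ ≗ ρ′ → (∀ j → η j ≗ η′ j) →
                   evalT ρ η t ≡ evalT ρ′ η′ t
      evalT-cong t ρ≗ρ′ η≗η′ =
        trans (sym (evalT-ren t id id (λ _ → refl) (λ _ _ → refl))) (evalT-ren t id id ρ≗ρ′ η≗η′)

      module _ (σ : ℕ → Tm) (τ : ℕ → Fn) {ρ : ℕ → ℕ} {η : ℕ → ℕ → ℕ} where

        liftNσ-eval : ∀ {ρ′ : ℕ → ℕ} {x} → (∀ i → evalT ρ η (σ i) ≡ ρ′ i) →
                      ∀ i → evalT (x ∷ᵉ ρ) η (liftNσ σ i) ≡ (x ∷ᵉ ρ′) i
        liftNσ-eval hσ zero    = refl
        liftNσ-eval hσ (suc i) = trans (evalT-shiftN (σ i)) (hσ i)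

        liftNτ-eval : ∀ {η′ : ℕ → ℕ → ℕ} {x} → (∀ j → evalF ρ η (τ j) ≗ η′ j) →
                      ∀ j → evalF (x ∷ᵉ ρ) η (liftNτ τ j) ≗ η′ j
        liftNτ-eval hτ j y = trans (evalF-shiftN (τ j) y) (hτ j y)

        liftFσ-eval : ∀ {ρ′ : ℕ → ℕ} {g} → (∀ i → evalT ρ η (σ i) ≡ ρ′ i) →
                      ∀ i → evalT ρ (g ∷ᵉ η) (liftFσ σ i) ≡ ρ′ i
        liftFσ-eval hσ i = trans (evalT-shiftF (σ i)) (hσ i)

        liftFτ-eval : ∀ {η′ : ℕ → ℕ → ℕ} {g} → (∀ j → evalF ρ η (τ j) ≗ η′ j) →
                      ∀ j → evalF ρ (g ∷ᵉ η) (liftFτ τ j) ≗ (g ∷ᵉ η′) j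
        liftFτ-eval hτ zero    y = refl
        liftFτ-eval hτ (suc j) y = trans (evalF-shiftF (τ j) y) (hτ j y)

      mutual
        evalT-sub : ∀ t σ τ {ρ η ρ′ η′} →
                    (∀ i → evalT ρ η (σ i) ≡ ρ′ i) → (∀ j → evalF ρ η (τ j) ≗ η′ j) →
                    evalT ρ η (subT σ τ t) ≡ evalT ρ′ η′ t
        evalT-sub (var i)       σ τ hσ hτ = hσ i
        evalT-sub zer           σ τ hσ hτ = refl
        evalT-sub (con c ts fs) σ τ hσ hτ =
          trans (cong (λ xs → I c xs _) (evalTs-sub ts σ τ hσ hτ)) (I-ext c _ (evalFs-sub fs σ τ hσ hτ))
        evalT-sub (ap f t)      σ τ {ρ} {η} hσ hτ =
          trans (cong (evalF ρ η (subF σ τ f)) (evalT-sub t σ τ hσ hτ)) (evalF-sub f σ τ hσ hτ _)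

        evalF-sub : ∀ f σ τ {ρ η ρ′ η′} →
                    (∀ i → evalT ρ η (σ i) ≡ ρ′ i) → (∀ j → evalF ρ η (τ j) ≗ η′ j) →
                    evalF ρ η (subF σ τ f) ≗ evalF ρ′ η′ f
        evalF-sub (fvar j) σ τ hσ hτ   = hτ j
        evalF-sub (lam t)  σ τ hσ hτ x =
          evalT-sub t (liftNσ σ) (liftNτ τ) (liftNσ-eval σ τ hσ) (liftNτ-eval σ τ hτ)

        evalTs-sub : ∀ {n} (ts : Vec Tm n) σ τ {ρ η ρ′ η′} → (∀ i → evalT ρ η (σ i) ≡ ρ′ i) →
                     (∀ j → evalF ρ η (τ j) ≗ η′ j) → evalTs ρ η (subTs σ τ ts) ≡ evalTs ρ′ η′ ts
        evalTs-sub []       σ τ hσ hτ = refl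
        evalTs-sub (t ∷ ts) σ τ hσ hτ = cong₂ _∷_ (evalT-sub t σ τ hσ hτ) (evalTs-sub ts σ τ hσ hτ)

        evalFs-sub : ∀ {n} (fs : Vec Fn n) σ τ {ρ η ρ′ η′} → (∀ i → evalT ρ η (σ i) ≡ ρ′ i) →
                     (∀ j → evalF ρ η (τ j) ≗ η′ j) →
                     Pointwise _≗_ (evalFs ρ η (subFs σ τ fs)) (evalFs ρ′ η′ fs)
        evalFs-sub []       σ τ hσ hτ = []
        evalFs-sub (f ∷ fs) σ τ hσ hτ = evalF-sub f σ τ hσ hτ ∷ evalFs-sub fs σ τ hσ hτ

      ⟦⟧-ren : ∀ A r p {ρ η ρ′ η′} → (∀ i → ρ (r i) ≡ ρ′ i) → (∀ j → η (p j) ≗ η′ j) →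
               ⟦ renFm r p A ⟧ ρ η ⇔ ⟦ A ⟧ ρ′ η′
      ⟦⟧-ren (s ≐ t)  r p hr hp = ≡-cong-⇔ (evalT-ren s r p hr hp) (evalT-ren t r p hr hp)
      ⟦⟧-ren ⊥'       r p hr hp = ⇔.refl
      ⟦⟧-ren (A ⇒ B)  r p hr hp = →-cong-⇔ (⟦⟧-ren A r p hr hp) (⟦⟧-ren B r p hr hp)
      ⟦⟧-ren (A ∧' B) r p hr hp = ⟦⟧-ren A r p hr hp ×-⇔ ⟦⟧-ren B r p hr hp
      ⟦⟧-ren (A ∨' B) r p hr hp = ⟦⟧-ren A r p hr hp ⊎-⇔ ⟦⟧-ren B r p hr hp
      ⟦⟧-ren (∀n A)   r p hr hp = Π-cong-⇔ λ x → ⟦⟧-ren A (liftR r) p (liftR-eval hr) hp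
      ⟦⟧-ren (∃n A)   r p hr hp = Σ-cong-⇔ λ x → ⟦⟧-ren A (liftR r) p (liftR-eval hr) hp
      ⟦⟧-ren (∀f A)   r p hr hp = Π-cong-⇔ λ g →
        →-cong-⇔ ⇔.refl (⟦⟧-ren A r (liftR p) hr (liftR-evalF hp))
      ⟦⟧-ren (∃f A)   r p hr hp = Σ-cong-⇔ λ g → ⇔.refl ×-⇔ ⟦⟧-ren A r (liftR p) hr (liftR-evalF hp)

      ⟦⟧-sub : ∀ A σ τ {ρ η ρ′ η′} →
               (∀ i → evalT ρ η (σ i) ≡ ρ′ i) → (∀ j → evalF ρ η (τ j) ≗ η′ j) →
               ⟦ subFm σ τ A ⟧ ρ η ⇔ ⟦ A ⟧ ρ′ η′
      ⟦⟧-sub (s ≐ t)  σ τ hσ hτ = ≡-cong-⇔ (evalT-sub s σ τ hσ hτ) (evalT-sub t σ τ hσ hτ)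
      ⟦⟧-sub ⊥'       σ τ hσ hτ = ⇔.refl
      ⟦⟧-sub (A ⇒ B)  σ τ hσ hτ = →-cong-⇔ (⟦⟧-sub A σ τ hσ hτ) (⟦⟧-sub B σ τ hσ hτ)
      ⟦⟧-sub (A ∧' B) σ τ hσ hτ = ⟦⟧-sub A σ τ hσ hτ ×-⇔ ⟦⟧-sub B σ τ hσ hτ
      ⟦⟧-sub (A ∨' B) σ τ hσ hτ = ⟦⟧-sub A σ τ hσ hτ ⊎-⇔ ⟦⟧-sub B σ τ hσ hτ
      ⟦⟧-sub (∀n A)   σ τ hσ hτ = Π-cong-⇔ λ x →
        ⟦⟧-sub A (liftNσ σ) (liftNτ τ) (liftNσ-eval σ τ hσ) (liftNτ-eval σ τ hτ)
      ⟦⟧-sub (∃n A)   σ τ hσ hτ = Σ-cong-⇔ λ x →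
        ⟦⟧-sub A (liftNσ σ) (liftNτ τ) (liftNσ-eval σ τ hσ) (liftNτ-eval σ τ hτ)
      ⟦⟧-sub (∀f A)   σ τ hσ hτ = Π-cong-⇔ λ g → →-cong-⇔ ⇔.refl
        (⟦⟧-sub A (liftFσ σ) (liftFτ τ) (liftFσ-eval σ τ hσ) (liftFτ-eval σ τ hτ))
      ⟦⟧-sub (∃f A)   σ τ hσ hτ = Σ-cong-⇔ λ g → ⇔.refl ×-⇔
        ⟦⟧-sub A (liftFσ σ) (liftFτ τ) (liftFσ-eval σ τ hσ) (liftFτ-eval σ τ hτ)

      ⟦⟧-[]n : ∀ A t {ρ η} → ⟦ A [ t ]n ⟧ ρ η ⇔ ⟦ A ⟧ (evalT ρ η t ∷ᵉ ρ) η
      ⟦⟧-[]n A t = ⟦⟧-sub A (sub0 t) fvar (λ { zero → refl ; (suc i) → refl }) (λ _ _ → refl)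

      ⟦⟧-[]f : ∀ A φ {ρ η} → ⟦ A [ φ ]f ⟧ ρ η ⇔ ⟦ A ⟧ ρ (evalF ρ η φ ∷ᵉ η)
      ⟦⟧-[]f A φ = ⟦⟧-sub A var (fsub0 φ) (λ _ → refl) (λ { zero _ → refl ; (suc j) _ → refl })

      ⟦⟧-shN : ∀ A {x ρ η} → ⟦ shN A ⟧ (x ∷ᵉ ρ) η ⇔ ⟦ A ⟧ ρ η
      ⟦⟧-shN A = ⟦⟧-ren A suc id (λ _ → refl) (λ _ _ → refl)

      ⟦⟧-shF : ∀ A {g ρ η} → ⟦ shF A ⟧ ρ (g ∷ᵉ η) ⇔ ⟦ A ⟧ ρ η
      ⟦⟧-shF A = ⟦⟧-ren A id suc (λ _ → refl) (λ _ _ → refl)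

      valid-repl : ∀ A s t ρ η → ⟦ A [ s ]n ∧' s ≐ t ⇒ A [ t ]n ⟧ ρ η
      valid-repl A s t ρ η (A[s] , s≡t) =
        from (⟦⟧-[]n A t) (subst (λ v → ⟦ A ⟧ (v ∷ᵉ ρ) η) s≡t (to (⟦⟧-[]n A s) A[s]))

      valid-lam : ∀ t s ρ η → ⟦ ap (lam t) s ≐ t [ s ]t ⟧ ρ η
      valid-lam t s ρ η = sym (evalT-sub t (sub0 s) fvar (λ { zero → refl ; (suc i) → refl }) (λ _ _ → refl))

      valid-ind : (S : Tm → Tm) → (∀ {x ρ η} → evalT (x ∷ᵉ ρ) η (S (var zero)) ≡ suc x) →
                  ∀ A ρ η → ⟦ A [ zer ]n ∧' ∀n (A ⇒ subFm (sub0keep (S (var zero))) fvar A) ⇒ ∀n A ⟧ ρ η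
      valid-ind S S-eval A ρ η (base , step) = induction
        where
        induction : ∀ x → ⟦ A ⟧ (x ∷ᵉ ρ) η
        induction zero    = to (⟦⟧-[]n A zer) base
        induction (suc x) = to (⟦⟧-sub A (sub0keep (S (var zero))) fvar
                                  (λ { zero → S-eval ; (suc i) → refl }) (λ _ _ → refl))
                               (step x (induction x))

  Agree : Interpretation → Interpretation → Con → Set
  Agree I J c = ∀ xs gs → I c xs gs ≡ J c xs gs

  module _ (I J : Interpretation) (J-ext : Extensional J) where
    private
      module I = Eval I
      module J = Eval J

    mutual
      evalT-agree : ∀ t → AllConstT (Agree I J) t → ∀ ρ η → I.evalT ρ η t ≡ J.evalT ρ η t
      evalT-agree (var i)       _                  ρ η = refl
      evalT-agree zer           _                  ρ η = refl
      evalT-agree (con c ts fs) (agree , tsA , fsA) ρ η =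
        trans (agree _ _)
              (trans (cong (λ xs → J c xs _) (evalTs-agree ts tsA ρ η)) (J-ext c _ (evalFs-agree fs fsA ρ η)))
      evalT-agree (ap f t)      (fA , tA)          ρ η =
        trans (evalF-agree f fA ρ η _) (cong (J.evalF ρ η f) (evalT-agree t tA ρ η))

      evalF-agree : ∀ f → AllConstF (Agree I J) f → ∀ ρ η → I.evalF ρ η f ≗ J.evalF ρ η f
      evalF-agree (fvar j) _  ρ η x = refl
      evalF-agree (lam t)  tA ρ η x = evalT-agree t tA (x ∷ᵉ ρ) η

      evalTs-agree : ∀ {n} (ts : Vec Tm n) → AllConstTs (Agree I J) ts → ∀ ρ η →
                     I.evalTs ρ η ts ≡ J.evalTs ρ η ts
      evalTs-agree []       _          ρ η = refl
      evalTs-agree (t ∷ ts) (tA , tsA) ρ η = cong₂ _∷_ (evalT-agree t tA ρ η) (evalTs-agree ts tsA ρ η)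

      evalFs-agree : ∀ {n} (fs : Vec Fn n) → AllConstFs (Agree I J) fs → ∀ ρ η →
                     Pointwise _≗_ (I.evalFs ρ η fs) (J.evalFs ρ η fs)
      evalFs-agree []       _          ρ η = []
      evalFs-agree (f ∷ fs) (fA , fsA) ρ η = evalF-agree f fA ρ η ∷ evalFs-agree fs fsA ρ η

  EnvBounded : ℕ → ℕ → (ℕ → ℕ) → (ℕ → ℕ → ℕ) → Set
  EnvBounded k m ρ η = (∀ i → ρ i ≤ m) × (∀ j → Bounded k m (η j))

  EnvBounded-∷ᵉ : ∀ {k m ρ η} x → EnvBounded k m ρ η → EnvBounded k (x ⊔ m) (x ∷ᵉ ρ) η
  EnvBounded-∷ᵉ {k} x (ρ≤m , η≤) = (λ { zero → m≤m⊔n x _ ; (suc i) → m≤n⇒m≤o⊔n x (ρ≤m i) }) ,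
                               (λ j → Bounded-mono {k} ≤-refl (m≤n⊔m x _) (η≤ j))

  MajorizableConst : Interpretation → Con → Set
  MajorizableConst I c = Majorizable (I c)

  module _ (I : Interpretation) where
    open Eval I

    mutual
      term-bound : ∀ t → AllConstT (MajorizableConst I) t → ∀ k →
                   Σ ℕ λ k′ → ∀ {m ρ η} → EnvBounded k m ρ η → evalT ρ η t ≤ F k′ m
      term-bound (var i)       _ k = 0 , λ (ρ≤m , _) → ≤-trans (ρ≤m i) (<⇒≤ (F-inflationary 0 _))
      term-bound zer           _ k = 0 , λ _ → z≤n
      term-bound (con c ts fs) (c-maj , tsM , fsM) k
        with terms-bound ts tsM k | funs-bound fs fsM k
      ... | k₁ , ts≤ | k₂ , fs≤ with c-maj (k₁ ⊔ k₂)
      ...   | k′ , c≤ = suc (k′ ⊔ (k₁ ⊔ k₂)) , λ {m} env →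
        let M = F (k₁ ⊔ k₂) m in
        ≤-trans (c≤ M (All.map (λ x≤ → ≤-trans x≤ (F-monoˡ (m≤m⊔n k₁ k₂) m)) (ts≤ env))
                      (All.map (Bounded-mono (m≤n⊔m k₁ k₂) (<⇒≤ (F-inflationary (k₁ ⊔ k₂) m))) (fs≤ env)))
                (F-compose k′ (k₁ ⊔ k₂) m)
      term-bound (ap f t)      (fM , tM) k with fun-bound f fM k | term-bound t tM k
      ... | k₁ , f≤ | k₂ , t≤ = suc (k₁ ⊔ k₂) , λ {m} env →
        ≤-trans (f≤ env _)
          (≤-trans (F-monoʳ k₁ (⊔-lub (t≤ env) (<⇒≤ (F-inflationary k₂ m)))) (F-compose k₁ k₂ m))

      fun-bound : ∀ f → AllConstF (MajorizableConst I) f → ∀ k →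
                  Σ ℕ λ k′ → ∀ {m ρ η} → EnvBounded k m ρ η → Bounded k′ m (evalF ρ η f)
      fun-bound (fvar j) _  k = k , λ (_ , η≤) → η≤ j
      fun-bound (lam t)  tM k with term-bound t tM k
      ... | k′ , t≤ = k′ , λ env x → t≤ (EnvBounded-∷ᵉ {k} x env)

      terms-bound : ∀ {n} (ts : Vec Tm n) → AllConstTs (MajorizableConst I) ts → ∀ k →
                    Σ ℕ λ k′ → ∀ {m ρ η} → EnvBounded k m ρ η → All (_≤ F k′ m) (evalTs ρ η ts)
      terms-bound []       _          k = 0 , λ _ → []
      terms-bound (t ∷ ts) (tM , tsM) k with term-bound t tM k | terms-bound ts tsM k
      ... | k₁ , t≤ | k₂ , ts≤ = k₁ ⊔ k₂ , λ {m} env →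
        ≤-trans (t≤ env) (F-monoˡ (m≤m⊔n k₁ k₂) m) ∷
        All.map (λ x≤ → ≤-trans x≤ (F-monoˡ (m≤n⊔m k₁ k₂) m)) (ts≤ env)

      funs-bound : ∀ {n} (fs : Vec Fn n) → AllConstFs (MajorizableConst I) fs → ∀ k →
                   Σ ℕ λ k′ → ∀ {m ρ η} → EnvBounded k m ρ η → All (Bounded k′ m) (evalFs ρ η fs)
      funs-bound []       _          k = 0 , λ _ → []
      funs-bound (f ∷ fs) (fM , fsM) k with fun-bound f fM k | funs-bound fs fsM k
      ... | k₁ , f≤ | k₂ , fs≤ = k₁ ⊔ k₂ , λ {m} env →
        Bounded-mono {m = m} (m≤m⊔n k₁ k₂) ≤-refl (f≤ env) ∷
        All.map (Bounded-mono {m = m} (m≤n⊔m k₁ k₂) ≤-refl) (fs≤ env)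

  module Soundness (I : Interpretation) (I-ext : Extensional I) (I-maj : ∀ c → Majorizable (I c))
                   (Ax : Fm → Set) (Ax-valid : ∀ {A} → Ax A → ∀ ρ η → Eval.⟦_⟧ I A ρ η) where
    open Eval I
    open Substitution I-ext
    open Deriv Ax

    -- The bound covers all variables, not only the free ones: every binder preserves it, so no
    -- free-variable bookkeeping is needed.
    Admissible : (ℕ → ℕ) → (ℕ → ℕ → ℕ) → Set
    Admissible ρ η = Σ ℕ λ k → Σ ℕ λ m → EnvBounded k m ρ η

    Admissible-∷ⁿ : ∀ {ρ η} x → Admissible ρ η → Admissible (x ∷ᵉ ρ) η
    Admissible-∷ⁿ x (k , m , env) = k , x ⊔ m , EnvBounded-∷ᵉ {k} x env

    Admissible-∷ᶠ : ∀ {ρ η g} → Dominated g → Admissible ρ η → Admissible ρ (g ∷ᵉ η)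
    Admissible-∷ᶠ (k₁ , m₁ , g≤) (k₂ , m₂ , ρ≤ , η≤) =
      k₁ ⊔ k₂ , m₁ ⊔ m₂ , (λ i → ≤-trans (ρ≤ i) (m≤n⊔m m₁ m₂)) ,
      λ { zero    → Bounded-mono (m≤m⊔n k₁ k₂) (m≤m⊔n m₁ m₂) g≤
        ; (suc j) → Bounded-mono (m≤n⊔m k₁ k₂) (m≤n⊔m m₁ m₂) (η≤ j) }

    evalF-dominated : ∀ φ {ρ η} → Admissible ρ η → Dominated (evalF ρ η φ)
    evalF-dominated φ (k , m , env) with fun-bound I φ (allConstF I-maj φ) k
    ... | k′ , φ≤ = k′ , m , φ≤ env

    Holds : List Fm → (ℕ → ℕ) → (ℕ → ℕ → ℕ) → Set
    Holds Γ ρ η = ListAll.All (λ A → ⟦ A ⟧ ρ η) Γ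

    Holds-shN : ∀ {Γ ρ η x} → Holds Γ ρ η → Holds (map shN Γ) (x ∷ᵉ ρ) η
    Holds-shN γ = ListAll.map⁺ (ListAll.map (λ {A} → from (⟦⟧-shN A)) γ)

    Holds-shF : ∀ {Γ ρ η g} → Holds Γ ρ η → Holds (map shF Γ) ρ (g ∷ᵉ η)
    Holds-shF γ = ListAll.map⁺ (ListAll.map (λ {A} → from (⟦⟧-shF A)) γ)

    sound : ∀ {Γ A} → Γ ⊢ A → ∀ {ρ η} → Admissible ρ η → Holds Γ ρ η → ⟦ A ⟧ ρ η
    sound (hyp A∈Γ) adm γ = ListAll.lookup γ A∈Γ
    sound (ax Ax-A) {ρ} {η} adm γ = Ax-valid Ax-A ρ η
    sound (⇒I d)    adm γ = λ a → sound d adm (a ListAll.∷ γ)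
    sound (⇒E d e)  adm γ = sound d adm γ (sound e adm γ)
    sound (∧I d e)  adm γ = sound d adm γ , sound e adm γ
    sound (∧E₁ d)   adm γ = proj₁ (sound d adm γ)
    sound (∧E₂ d)   adm γ = proj₂ (sound d adm γ)
    sound (∨I₁ d)   adm γ = inj₁ (sound d adm γ)
    sound (∨I₂ d)   adm γ = inj₂ (sound d adm γ)
    sound (∨E d e f) adm γ with sound d adm γ
    ... | inj₁ a = sound e adm (a ListAll.∷ γ)
    ... | inj₂ b = sound f adm (b ListAll.∷ γ)
    sound (⊥E d)    adm γ = ⊥-elim (sound d adm γ)
    sound (∀nI d)   adm γ = λ x → sound d (Admissible-∷ⁿ x adm) (Holds-shN γ)
    sound (∀nE {A = A} d t) adm γ = from (⟦⟧-[]n A t) (sound d adm γ _)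
    sound (∃nI {A = A} t d) adm γ = _ , to (⟦⟧-[]n A t) (sound d adm γ)
    sound (∃nE {B = B} d e) adm γ with sound d adm γ
    ... | x , a = to (⟦⟧-shN B) (sound e (Admissible-∷ⁿ x adm) (a ListAll.∷ Holds-shN γ))
    sound (∀fI d)   adm γ = λ g g-dom → sound d (Admissible-∷ᶠ g-dom adm) (Holds-shF γ)
    sound (∀fE {A = A} d φ) adm γ = from (⟦⟧-[]f A φ) (sound d adm γ _ (evalF-dominated φ adm))
    sound (∃fI {A = A} φ d) adm γ = _ , evalF-dominated φ adm , to (⟦⟧-[]f A φ) (sound d adm γ)
    sound (∃fE {B = B} d e) adm γ with sound d adm γ
    ... | g , g-dom , a = to (⟦⟧-shF B) (sound e (Admissible-∷ᶠ g-dom adm) (a ListAll.∷ Holds-shF γ))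

    QF-AC-unprovable : ¬ (∀ A → QF A → Proves (QFAC A))
    QF-AC-unprovable proves =
      let α , α-dom , section = sound (proves β[y]≡x (qf-eq _ _)) β-admissible ListAll.[] β-surjective
      in β-no-dominated-section α α-dom section
      where
      -- A(x, y) :≡ f(y) = x (in QFAC, var 1 is x and var 0 is y), with the parameter f read as β.
      β[y]≡x : Fm
      β[y]≡x = ap (fvar zero) (var zero) ≐ var (suc zero)
      β-admissible : Admissible (λ _ → 0) (λ _ → β)
      β-admissible = 0 , 0 , (λ _ → z≤n) , (λ _ → β-bounded)

-- The model of HA₁

precIt : ∀ {n} → (Vec ℕ n → ℕ) → (Vec ℕ (suc (suc n)) → ℕ) → ℕ → Vec ℕ n → ℕ
precIt g h zero    xs = g xs
precIt g h (suc y) xs = h (precIt g h y xs ∷ y ∷ xs)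

mutual
  evalPR : ∀ {n} → PR n → Vec ℕ n → ℕ
  evalPR succ        (x ∷ []) = suc x
  evalPR (zro n)     xs       = 0
  evalPR (proj i)    xs       = lookup xs i
  evalPR (comp g hs) xs       = evalPR g (evalPRs hs xs)
  evalPR (prec g h)  (y ∷ xs) = precIt (evalPR g) (evalPR h) y xs

  evalPRs : ∀ {m n} → Vec (PR n) m → Vec ℕ n → Vec ℕ m
  evalPRs []       xs = []
  evalPRs (h ∷ hs) xs = evalPR h xs ∷ evalPRs hs xs

mutual
  PR-bound : ∀ {n} (f : PR n) → Σ ℕ λ k → ∀ m {xs} → All (_≤ m) xs → evalPR f xs ≤ F k m
  PR-bound succ        = 0 , λ { m (x≤m ∷ []) → s≤s (m≤n⇒m≤1+n x≤m) }
  PR-bound (zro n)     = 0 , λ _ _ → z≤n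
  PR-bound (proj i)    = 0 , λ m xs≤ → ≤-trans (lookup⁺ xs≤ i) (<⇒≤ (F-inflationary 0 m))
  PR-bound (comp g hs) with PR-bound g | PRs-bound hs
  ... | k₁ , g≤ | k₂ , hs≤ = suc (k₁ ⊔ k₂) , λ m xs≤ →
    ≤-trans (g≤ (F k₂ m) (hs≤ m xs≤)) (F-compose k₁ k₂ m)
  PR-bound (prec g h)  with PR-bound g | PR-bound h
  ... | k₀ , g≤ | k₁ , h≤ = suc (suc k₁ ⊔ k₀) , λ { m {y ∷ xs} (y≤m ∷ xs≤) →
    iteration-bound (λ y → precIt (evalPR g) (evalPR h) y xs) k₀ k₁ m (g≤ m xs≤)
      (λ y z a≤z y≤z m≤z → h≤ z (a≤z ∷ y≤z ∷ All.map (λ x≤m → ≤-trans x≤m m≤z) xs≤)) y y≤m }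

  PRs-bound : ∀ {l n} (hs : Vec (PR n) l) →
              Σ ℕ λ k → ∀ m {xs} → All (_≤ m) xs → All (_≤ F k m) (evalPRs hs xs)
  PRs-bound []       = 0 , λ _ _ → []
  PRs-bound (h ∷ hs) with PR-bound h | PRs-bound hs
  ... | k₁ , h≤ | k₂ , hs≤ = k₁ ⊔ k₂ , λ m xs≤ →
    ≤-trans (h≤ m xs≤) (F-monoˡ (m≤m⊔n k₁ k₂) m) ∷
    All.map (λ x≤ → ≤-trans x≤ (F-monoˡ (m≤n⊔m k₁ k₂) m)) (hs≤ m xs≤)

recursor : (ℕ → ℕ → ℕ) → ℕ → (ℕ → ℕ) → ℕ → ℕ
recursor pair t u zero    = t
recursor pair t u (suc s) = u (pair (recursor pair t u s) s)

recursor-cong : ∀ pair t {u v} → u ≗ v → ∀ s → recursor pair t u s ≡ recursor pair t v s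
recursor-cong pair t u≗v zero        = refl
recursor-cong pair t {u} u≗v (suc s) =
  trans (cong (λ r → u (pair r s)) (recursor-cong pair t u≗v s)) (u≗v _)

recursor-bound : ∀ pair kp → (∀ {a b z} → a ≤ z → b ≤ z → pair a b ≤ F kp z) →
                 ∀ k → Σ ℕ λ k′ → ∀ m {t s u} → t ≤ m → s ≤ m → Bounded k m u →
                 recursor pair t u s ≤ F k′ m
recursor-bound pair kp pair≤ k = suc (suc k₁ ⊔ 0) , bound
  where
  k₁ = suc (k ⊔ kp)
  bound : ∀ m {t s u} → t ≤ m → s ≤ m → Bounded k m u → recursor pair t u s ≤ F (suc (suc k₁ ⊔ 0)) m
  bound m {t} {s} {u} t≤m s≤m u≤ =
    iteration-bound (recursor pair t u) 0 k₁ m (≤-trans t≤m (<⇒≤ (F-inflationary 0 m))) step s s≤m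
    where
    step : ∀ y z → recursor pair t u y ≤ z → y ≤ z → m ≤ z → recursor pair t u (suc y) ≤ F k₁ z
    step y z r≤z y≤z m≤z = begin
      u p                ≤⟨ u≤ p ⟩
      F k (p ⊔ m)        ≤⟨ F-monoʳ k (⊔-lub (pair≤ r≤z y≤z) (≤-trans m≤z (<⇒≤ (F-inflationary kp z)))) ⟩
      F k (F kp z)       ≤⟨ F-compose k kp z ⟩
      F (suc (k ⊔ kp)) z ∎
      where
      open ≤-Reasoning
      p = pair (recursor pair t u y) y

⟨_,_⟩ : ℕ → ℕ → ℕ
⟨ a , b ⟩ = evalPR pairPR (a ∷ b ∷ [])

⟨,⟩-bound : ∀ {a b z} → a ≤ z → b ≤ z → ⟨ a , b ⟩ ≤ F (proj₁ (PR-bound pairPR)) z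
⟨,⟩-bound {z = z} a≤z b≤z = proj₂ (PR-bound pairPR) z (a≤z ∷ b≤z ∷ [])

module HA-Model where
  open HA1
  open Semantics HASig

  model : Interpretation
  model (pr n f) xs           []       = evalPR f xs
  model rec      (t ∷ s ∷ []) (u ∷ []) = recursor ⟨_,_⟩ t u s

  model-extensional : Extensional model
  model-extensional (pr n f) xs           []          = refl
  model-extensional rec      (t ∷ s ∷ []) (u≗v ∷ []) = recursor-cong ⟨_,_⟩ t u≗v s

  -- kp stays abstract: with the computed level of pairPR in its place, conversion checking unfolds F.
  majorizable-rec : ∀ kp → (∀ {a b z} → a ≤ z → b ≤ z → ⟨ a , b ⟩ ≤ F kp z) →
                    Majorizable (model rec)
  majorizable-rec kp pair≤ k with recursor-bound ⟨_,_⟩ kp pair≤ k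
  ... | k′ , rec≤ = k′ , λ { m (t≤m ∷ s≤m ∷ []) (u≤ ∷ []) → rec≤ m t≤m s≤m u≤ }

  majorizable : ∀ c → Majorizable (model c)
  majorizable (pr n f) k = proj₁ (PR-bound f) , λ { m xs≤ [] → proj₂ (PR-bound f) m xs≤ }
  majorizable rec        = majorizable-rec (proj₁ (PR-bound pairPR)) ⟨,⟩-bound

  open Eval model
  open Substitution model-extensional

  evalTs-lookup : ∀ {n} ρ η (ts : Vec Tm n) i → lookup (evalTs ρ η ts) i ≡ evalT ρ η (lookup ts i)
  evalTs-lookup ρ η (t ∷ ts) Fin.zero    = refl
  evalTs-lookup ρ η (t ∷ ts) (Fin.suc i) = evalTs-lookup ρ η ts i

  evalTs-mapApp : ∀ {l n} ρ η (hs : Vec (PR n) l) ts → evalTs ρ η (mapApp hs ts) ≡ evalPRs hs (evalTs ρ η ts)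
  evalTs-mapApp ρ η []       ts = refl
  evalTs-mapApp ρ η (h ∷ hs) ts = cong (_ ∷_) (evalTs-mapApp ρ η hs ts)

  valid : ∀ {A} → Ax A → ∀ ρ η → ⟦ A ⟧ ρ η
  valid (eq-refl t)         ρ η = refl
  valid (eq-repl A s t)     ρ η = valid-repl A s t ρ η
  valid (ind A)             ρ η = valid-ind S refl A ρ η
  valid S≠0                 ρ η = λ ()
  valid (d-zro n ts)        ρ η = refl
  valid (d-proj i ts)       ρ η = evalTs-lookup ρ η ts i
  valid (d-comp g hs ts)    ρ η = cong (evalPR g) (sym (evalTs-mapApp ρ η hs ts))
  valid (d-prec0 g h ts)    ρ η = refl
  valid (d-precS g h s ts)  ρ η = refl
  valid (lam-conv t s)      ρ η = valid-lam t s ρ η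
  valid (rec0 t u)          ρ η = refl
  valid (recS t u s)        ρ η = refl

  open Soundness model model-extensional majorizable Ax valid public using (QF-AC-unprovable)

-- The model of IA₁

-- Out-of-range indices give 0, as the defaults of vσ and vτ do.
nth : ∀ {n} → Vec ℕ n → ℕ → ℕ
nth []       _       = 0
nth (x ∷ xs) zero    = x
nth (x ∷ xs) (suc i) = nth xs i

fnth : ∀ {n} → Vec (ℕ → ℕ) n → ℕ → ℕ → ℕ
fnth []       _       _ = 0
fnth (g ∷ gs) zero      = g
fnth (g ∷ gs) (suc j)   = fnth gs j

nth-≤ : ∀ {n m} {xs : Vec ℕ n} → All (_≤ m) xs → ∀ i → nth xs i ≤ m
nth-≤ []          i       = z≤n
nth-≤ (x≤m ∷ _)   zero    = x≤m
nth-≤ (_ ∷ xs≤m)  (suc i) = nth-≤ xs≤m i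

fnth-bounded : ∀ {n k m} {gs : Vec (ℕ → ℕ) n} → All (Bounded k m) gs → ∀ j → Bounded k m (fnth gs j)
fnth-bounded []          j       x = z≤n
fnth-bounded (g≤ ∷ _)    zero      = g≤
fnth-bounded {k = k} {m} (_ ∷ gs≤) (suc j) = fnth-bounded {k = k} {m} gs≤ j

fnth-cong : ∀ {n} {gs hs : Vec (ℕ → ℕ) n} → Pointwise _≗_ gs hs → ∀ j → fnth gs j ≗ fnth hs j
fnth-cong []           j       x = refl
fnth-cong (g≗h ∷ _)    zero      = g≗h
fnth-cong (_ ∷ gs≗hs)  (suc j)   = fnth-cong gs≗hs j

module IA-Model (E : IAExt) where
  open IAExt E
  open IA1 E
  open IADef kA mA
  open Semantics (IASig K kA mA)

  module _ {P : IACon K → Set} {i : Fin K} (below⇒P : ∀ c → BelowC i c → P c) where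
    mutual
      below⇒allConstT : ∀ t → BelowT i t → AllConstT P t
      below⇒allConstT (var _)       _                 = tt
      below⇒allConstT zer           _                 = tt
      below⇒allConstT (con c ts fs) (c< , ts< , fs<)  =
        below⇒P c c< , below⇒allConstTs ts ts< , below⇒allConstFs fs fs<
      below⇒allConstT (ap f t)      (f< , t<)         = below⇒allConstF f f< , below⇒allConstT t t<

      below⇒allConstF : ∀ f → BelowF i f → AllConstF P f
      below⇒allConstF (fvar _) _  = tt
      below⇒allConstF (lam t)  t< = below⇒allConstT t t<

      below⇒allConstTs : ∀ {n} (ts : Vec Tm n) → BelowTs i ts → AllConstTs P ts
      below⇒allConstTs []       _          = tt
      below⇒allConstTs (t ∷ ts) (t< , ts<) = below⇒allConstT t t< , below⇒allConstTs ts ts<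

      below⇒allConstFs : ∀ {n} (fs : Vec Fn n) → BelowFs i fs → AllConstFs P fs
      below⇒allConstFs []       _          = tt
      below⇒allConstFs (f ∷ fs) (f< , fs<) = below⇒allConstF f f< , below⇒allConstFs fs fs<

  module _ (J : Interpretation) where
    open Eval J

    primIt : Tm → Tm → ℕ → (ℕ → ℕ) → (ℕ → ℕ → ℕ) → ℕ
    primIt t₀ t₁ zero    ρ η = evalT ρ η t₀
    primIt t₀ t₁ (suc y) ρ η = evalT (primIt t₀ t₁ y ρ η ∷ᵉ y ∷ᵉ ρ) η t₁

    defEval : (i : Fin K) → Defn i → Vec ℕ (kA i) → Vec (ℕ → ℕ) (mA i) → ℕ
    defEval i (explicit t _)        xs gs = evalT (nth xs) (fnth gs) t
    defEval i (primrec t₀ t₁ _ _ _) xs gs = primIt t₀ t₁ (nth xs 0) (nth xs ∘ suc) (fnth gs)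

    module _ (J-ext : Extensional J) where
      open Substitution J-ext

      primIt-cong : ∀ t₀ t₁ y {ρ ρ′ η η′} → ρ ≗ ρ′ → (∀ j → η j ≗ η′ j) →
                    primIt t₀ t₁ y ρ η ≡ primIt t₀ t₁ y ρ′ η′
      primIt-cong t₀ t₁ zero    ρ≗ρ′ η≗η′ = evalT-cong t₀ ρ≗ρ′ η≗η′
      primIt-cong t₀ t₁ (suc y) ρ≗ρ′ η≗η′ = evalT-cong t₁
        (λ { zero → primIt-cong t₀ t₁ y ρ≗ρ′ η≗η′ ; (suc zero) → refl ; (suc (suc j)) → ρ≗ρ′ j }) η≗η′

      defEval-cong : ∀ i d xs {gs hs} → Pointwise _≗_ gs hs → defEval i d xs gs ≡ defEval i d xs hs
      defEval-cong i (explicit t _)        xs gs≗hs = evalT-cong t (λ _ → refl) (fnth-cong gs≗hs)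
      defEval-cong i (primrec t₀ t₁ _ _ _) xs gs≗hs =
        primIt-cong t₀ t₁ (nth xs 0) {nth xs ∘ suc} (λ _ → refl) (fnth-cong gs≗hs)

  module _ (J J′ : Interpretation) (J′-ext : Extensional J′) where
    open Eval.Substitution J′ J′-ext using (evalT-cong)

    primIt-agree : ∀ t₀ t₁ → AllConstT (Agree J J′) t₀ → AllConstT (Agree J J′) t₁ →
                   ∀ y ρ η → primIt J t₀ t₁ y ρ η ≡ primIt J′ t₀ t₁ y ρ η
    primIt-agree t₀ t₁ t₀-agree t₁-agree zero    ρ η = evalT-agree J J′ J′-ext t₀ t₀-agree ρ η
    primIt-agree t₀ t₁ t₀-agree t₁-agree (suc y) ρ η =
      trans (evalT-agree J J′ J′-ext t₁ t₁-agree _ η)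
            (evalT-cong t₁ (λ { zero → primIt-agree t₀ t₁ t₀-agree t₁-agree y ρ η ; (suc _) → refl })
                           (λ _ _ → refl))

    defEval-agree : ∀ i → (∀ c → BelowC i c → Agree J J′ c) →
                    ∀ d xs gs → defEval J i d xs gs ≡ defEval J′ i d xs gs
    defEval-agree i below-agree (explicit t t<) xs gs =
      evalT-agree J J′ J′-ext t (below⇒allConstT below-agree t t<) (nth xs) (fnth gs)
    defEval-agree i below-agree (primrec t₀ t₁ t₀< t₁< _) xs gs =
      primIt-agree t₀ t₁ (below⇒allConstT below-agree t₀ t₀<) (below⇒allConstT below-agree t₁ t₁<)
                   (nth xs 0) (nth xs ∘ suc) (fnth gs)

  -- layer n interprets the first n defined constants correctly and the later ones as 0; since a
  -- definition mentions only earlier constants, layer K satisfies every defining equation.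
  layer : ℕ → Interpretation
  layer n       sc      (x ∷ [])     [] = suc x
  layer n       pl      (x ∷ y ∷ []) [] = x + y
  layer n       ml      (x ∷ y ∷ []) [] = x * y
  layer zero    (ext i) xs           gs = 0
  layer (suc n) (ext i) xs           gs = defEval (layer n) i (defn i) xs gs

  layer-extensional : ∀ n → Extensional (layer n)
  layer-extensional n       sc      (x ∷ [])     [] = refl
  layer-extensional n       pl      (x ∷ y ∷ []) [] = refl
  layer-extensional n       ml      (x ∷ y ∷ []) [] = refl
  layer-extensional zero    (ext i) xs           _  = refl
  layer-extensional (suc n) (ext i) xs           gs≗hs = defEval-cong (layer n) (layer-extensional n) i (defn i) xs gs≗hs

  mutual
    layers-agree : ∀ n i → toℕ i < n → Agree (layer n) (layer (suc n)) (ext i)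
    layers-agree (suc n) i i<1+n =
      defEval-agree (layer n) (layer (suc n)) (layer-extensional (suc n)) i
                    (layers-agree-below n i (≤-pred i<1+n)) (defn i)

    layers-agree-below : ∀ n i → toℕ i ≤ n → ∀ c → BelowC i c → Agree (layer n) (layer (suc n)) c
    layers-agree-below n i i≤n sc      _   (x ∷ [])     [] = refl
    layers-agree-below n i i≤n pl      _   (x ∷ y ∷ []) [] = refl
    layers-agree-below n i i≤n ml      _   (x ∷ y ∷ []) [] = refl
    layers-agree-below n i i≤n (ext j) j<i = layers-agree n j (<-≤-trans j<i i≤n)

  model : Interpretation
  model = layer K

  model-extensional : Extensional model
  model-extensional = layer-extensional K

  model-unfold : ∀ i xs gs → model (ext i) xs gs ≡ defEval model i (defn i) xs gs
  model-unfold i = layers-agree K i (toℕ<n i)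

  defEval-majorizable : ∀ J i → (∀ c → BelowC i c → Majorizable (J c)) → ∀ d → Majorizable (defEval J i d)
  defEval-majorizable J i below (explicit t t<) k with term-bound J t (below⇒allConstT below t t<) k
  ... | k′ , t≤ = k′ , λ m xs≤ gs≤ → t≤ (nth-≤ xs≤ , fnth-bounded {k = k} {m} gs≤)
  defEval-majorizable J i below (primrec t₀ t₁ t₀< t₁< _) k
    with term-bound J t₀ (below⇒allConstT below t₀ t₀<) k | term-bound J t₁ (below⇒allConstT below t₁ t₁<) k
  ... | k₀ , t₀≤ | k₁ , t₁≤ = suc (suc k₁ ⊔ k₀) , λ m {xs} {gs} xs≤ gs≤ →
    let gs-bounded : ∀ {z} → m ≤ z → ∀ j → Bounded k z (fnth gs j)
        gs-bounded m≤z j = Bounded-mono {k} ≤-refl m≤z (fnth-bounded {k = k} {m} gs≤ j)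
    in iteration-bound (λ y → primIt J t₀ t₁ y (nth xs ∘ suc) (fnth gs)) k₀ k₁ m
         (t₀≤ (nth-≤ xs≤ ∘ suc , gs-bounded ≤-refl))
         (λ y z r≤z y≤z m≤z → t₁≤ ((λ { zero          → r≤z
                                        ; (suc zero)    → y≤z
                                        ; (suc (suc j)) → ≤-trans (nth-≤ xs≤ (suc j)) m≤z }) ,
                                   gs-bounded m≤z))
         (nth xs 0) (nth-≤ xs≤ 0)

  majorizable : ∀ c → Majorizable (model c)
  majorizable sc      k = 0 , λ { m (x≤m ∷ []) [] → s≤s (m≤n⇒m≤1+n x≤m) }
  majorizable pl      k = 1 , λ { m (x≤m ∷ y≤m ∷ []) [] → +≤F1 x≤m y≤m }
  majorizable ml      k = 2 , λ { m (x≤m ∷ y≤m ∷ []) [] → *≤F2 x≤m y≤m }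
  majorizable (ext i)   = WF.All.wfRec <-wellFounded _ (λ i → Majorizable (model (ext i))) step i
    where
    step : ∀ i → (∀ {j} → j <ᶠ i → Majorizable (model (ext j))) → Majorizable (model (ext i))
    step i IH = Majorizable-cong (model-unfold i) (defEval-majorizable model i below (defn i))
      where
      below : ∀ c → BelowC i c → Majorizable (model c)
      below sc      _   = majorizable sc
      below pl      _   = majorizable pl
      below ml      _   = majorizable ml
      below (ext j) j<i = IH j<i

  open Eval model
  open Substitution model-extensional

  vσ-eval : ∀ {n} ρ η (ts : Vec Tm n) j → evalT ρ η (vσ ts j) ≡ nth (evalTs ρ η ts) j
  vσ-eval ρ η []       j       = refl
  vσ-eval ρ η (t ∷ ts) zero    = refl
  vσ-eval ρ η (t ∷ ts) (suc j) = vσ-eval ρ η ts j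

  vτ-eval : ∀ {n} ρ η (fs : Vec Fn n) j → evalF ρ η (vτ fs j) ≗ fnth (evalFs ρ η fs) j
  vτ-eval ρ η []       j       x = refl
  vτ-eval ρ η (f ∷ fs) zero    x = refl
  vτ-eval ρ η (f ∷ fs) (suc j) x = vτ-eval ρ η fs j x

  nth-vsetHead : ∀ {n} ρ η s (ts : Vec Tm n) → n ≡ suc (pred n) →
                 nth (evalTs ρ η (vsetHead s ts)) ≗ (evalT ρ η s ∷ᵉ λ j → evalT ρ η (vtail ts j))
  nth-vsetHead ρ η s (t ∷ ts) _ zero    = refl
  nth-vsetHead ρ η s (t ∷ ts) _ (suc j) = sym (vσ-eval ρ η ts j)

  evalT-primrec : ∀ {i t₀ t₁ b₀ b₁ e} → defn i ≡ primrec t₀ t₁ b₀ b₁ e → ∀ ρ η s ts fs →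
                  evalT ρ η (con (ext i) (vsetHead s ts) fs)
                  ≡ primIt model t₀ t₁ (evalT ρ η s) (λ j → evalT ρ η (vtail ts j)) (fnth (evalFs ρ η fs))
  evalT-primrec {i} {t₀} {t₁} {e = e} defn≡ ρ η s ts fs = begin
    model (ext i) xs gs
      ≡⟨ model-unfold i xs gs ⟩
    defEval model i (defn i) xs gs
      ≡⟨ cong (λ d → defEval model i d xs gs) defn≡ ⟩
    primIt model t₀ t₁ (nth xs 0) (nth xs ∘ suc) (fnth gs)
      ≡⟨ cong (λ y → primIt model t₀ t₁ y (nth xs ∘ suc) (fnth gs)) (args 0) ⟩
    primIt model t₀ t₁ (evalT ρ η s) (nth xs ∘ suc) (fnth gs)
      ≡⟨ primIt-cong model model-extensional t₀ t₁ (evalT ρ η s) {η = fnth gs} (args ∘ suc) (λ _ _ → refl) ⟩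
    primIt model t₀ t₁ (evalT ρ η s) (λ j → evalT ρ η (vtail ts j)) (fnth gs) ∎
    where
    open ≡-Reasoning
    xs = evalTs ρ η (vsetHead s ts)
    gs = evalFs ρ η fs
    args = nth-vsetHead ρ η s ts e

  valid : ∀ {A} → Ax A → ∀ ρ η → ⟦ A ⟧ ρ η
  valid (eq-refl t)      ρ η = refl
  valid (eq-repl A s t)  ρ η = valid-repl A s t ρ η
  valid (eq-fun φ s t)   ρ η = cong (evalF ρ η φ)
  valid (ind A)          ρ η = valid-ind S refl A ρ η
  valid (S-inj s t)      ρ η = suc-injective
  valid (S≠0 s)          ρ η = λ ()
  valid (plus0 a)        ρ η = +-identityʳ (evalT ρ η a)
  valid (plusS a b)      ρ η = +-suc (evalT ρ η a) (evalT ρ η b)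
  valid (times0 a)       ρ η = *-zeroʳ (evalT ρ η a)
  valid (timesS a b)     ρ η = trans (*-suc (evalT ρ η a) (evalT ρ η b)) (+-comm (evalT ρ η a) _)
  valid (lam-conv t s)   ρ η = valid-lam t s ρ η
  valid (d-expl i t b ts fs defn≡) ρ η =
    trans (model-unfold i _ _)
      (trans (cong (λ d → defEval model i d (evalTs ρ η ts) (evalFs ρ η fs)) defn≡)
             (sym (evalT-sub t (vσ ts) (vτ fs) (vσ-eval ρ η ts) (vτ-eval ρ η fs))))
  valid (d-rec0 i t₀ t₁ b₀ b₁ e ts fs defn≡) ρ η =
    trans (evalT-primrec defn≡ ρ η zer ts fs)
          (sym (evalT-sub t₀ (vtail ts) (vτ fs) (λ _ → refl) (vτ-eval ρ η fs)))
  valid (d-recS i t₀ t₁ b₀ b₁ e s ts fs defn≡) ρ η =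
    trans (evalT-primrec defn≡ ρ η (S s) ts fs)
          (sym (evalT-sub t₁ (recσ (con (ext i) (vsetHead s ts) fs) s (vtail ts)) (vτ fs) previous (vτ-eval ρ η fs)))
    where
    previous : ∀ j → evalT ρ η (recσ (con (ext i) (vsetHead s ts) fs) s (vtail ts) j) ≡ _
    previous zero          = evalT-primrec defn≡ ρ η s ts fs
    previous (suc zero)    = refl
    previous (suc (suc j)) = refl

  open Soundness model model-extensional majorizable Ax valid public using (QF-AC-unprovable)

theorem3p6 : (¬ (∀ (A : HA1.Fm) → HA1.QF A → HA1.Proves (HA1.QFAC A)))
           × ((E : IAExt) → ¬ (∀ (A : IA1.Fm E) → IA1.QF E A → IA1.Proves E (IA1.QFAC E A)))
theorem3p6 = HA-Model.QF-AC-unprovable , IA-Model.QF-AC-unprovable
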